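{- Let $\Sigma=\{\mathtt{a},\mathtt{b}\}$, let $k\in\mathbb{N}$ and let $w,w'\in\Sigma^*$ with $m\coloneqq\iota(w)=\iota(w')<k$, with $\alpha$-$\beta$-factorizations $w=\alpha_0\beta_1\alpha_1\cdots\beta_m\alpha_m$ and $w'=\alpha_0'\beta_1'\alpha_1'\cdots\beta_m'\alpha_m'$. Then $w\sim_k w'$ if and only if $\beta_i=\beta_i'$ for all $i\in\{1,\dots,m\}$ and $\alpha_i\sim_{k-m}\alpha_i'$ for all $i\in\{0,\dots,m\}$.
   Context: A word $u$ is a scattered factor of $w$ if $u$ is obtained from $w$ by deleting some letters (keeping order). For $k\in\mathbb{N}_0$, $u\sim_k v$ iff $u$ and $v$ have exactly the same scattered factors of length at most $k$. $\iota(w)$ is the largest $\ell$ such that every word of $\Sigma^\ell$ is a scattered factor of $w$. The arch factorization of $w$ is the unique factorization $w=\mathrm{ar}_1(w)\cdots\mathrm{ar}_\ell(w)\mathrm{re}(w)$ where each arch $\mathrm{ar}_i(w)$ contains every letter of $\Sigma$ and its last letter occurs exactly once in it, and $\mathrm{re}(w)$ does not contain every letter of $\Sigma$; $\ell=\iota(w)$. With $w^R$ the reversal, $\mathrm{ra}_i(w)\coloneqq(\mathrm{ar}_{\iota(w)-i+1}(w^R))^R$ and $\mathrm{er}(w)\coloneqq(\mathrm{re}(w^R))^R$. The $\alpha$-$\beta$-factorization of $w$ is $w=\alpha_0\beta_1\alpha_1\cdots\beta_{\iota(w)}\alpha_{\iota(w)}$ with $\mathrm{ar}_i(w)=\alpha_{i-1}\beta_i$,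 $\mathrm{ra}_i(w)=\beta_i\alpha_i$ for all $i\in\{1,\dots,\iota(w)\}$, $\alpha_0=\mathrm{er}(w)$, $\alpha_{\iota(w)}=\mathrm{re}(w)$. -}

module Defs where

open import Data.Nat using (ℕ; zero; suc)
open import Data.Fin using (Fin; zero; suc; inject₁; fromℕ; opposite)
open import Data.List using (List; []; _∷_; _++_; [_]; length; reverse)
open import Data.List.Membership.Propositional using (_∈_; _∉_)
open import Data.List.Relation.Binary.Sublist.Propositional using (_⊆_)
open import Data.Vec using (Vec; []; _∷_; lookup)
open import Data.Vec.Relation.Unary.All using (All)
open import Data.Product using (Σ; _×_; ∃; ∃-syntax)
open import Relation.Binary.PropositionalEquality using (_≡_)
open import Relation.Nullary using (¬_)
open import Data.Nat using (_≤_)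

data Letter : Set where
  a b : Letter

Word : Set
Word = List Letter

_≼_ : Word → Word → Set
u ≼ w = u ⊆ w

_∼[_]_ : Word → ℕ → Word → Set
u ∼[ k ] v = ∀ (x : Word) → length x ≤ k → (x ≼ u → x ≼ v) × (x ≼ v → x ≼ u)

HasAll : Word → Set
HasAll w = ∀ (x : Letter) → x ∈ w

IsIota : Word → ℕ → Set
IsIota w ℓ = (∀ (u : Word) → length u ≡ ℓ → u ≼ w)
           × ¬ (∀ (u : Word) → length u ≡ suc ℓ → u ≼ w)

IsArch : Word → Set
IsArch u = HasAll u × ∃[ u₀ ] ∃[ l ] (u ≡ u₀ ++ [ l ] × l ∉ u₀)

concatW : ∀ {n} → Vec Word n → Word
concatW [] = []
concatW (u ∷ us) = u ++ concatW us

IsArchFact : ∀ {ℓ} → Word → Vec Word ℓ → Word → Set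
IsArchFact w ars r = (w ≡ concatW ars ++ r) × All IsArch ars × ¬ HasAll r

abConcat : ∀ {m} → Vec Word (suc m) → Vec Word m → Word
abConcat (α ∷ []) [] = α
abConcat (α ∷ αs@(_ ∷ _)) (β ∷ βs) = α ++ β ++ abConcat αs βs

-- α-β-factorization of w with m = number of arches (0-based indices:
-- lookup αs i = α_i, lookup βs i = β_{i+1}).
-- ar_{i+1}(w) = α_i β_{i+1};  ra_{i+1}(w) = (ar_{m-i}(w^R))^R = β_{i+1} α_{i+1};
-- α₀ = er(w) = (re(w^R))^R;  α_m = re(w).
IsABFact : (w : Word) (m : ℕ) → Vec Word (suc m) → Vec Word m → Set
IsABFact w m αs βs =
  Σ (Vec Word m) λ ars → Σ Word λ r → Σ (Vec Word m) λ ars' → Σ Word λ r' →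
    IsArchFact w ars r
  × IsArchFact (reverse w) ars' r'
  × (w ≡ abConcat αs βs)
  × (∀ (i : Fin m) → lookup ars i ≡ lookup αs (inject₁ i) ++ lookup βs i)
  × (∀ (i : Fin m) → reverse (lookup ars' (opposite i)) ≡ lookup βs i ++ lookup αs (suc i))
  × (lookup αs zero ≡ reverse r')
  × (lookup αs (fromℕ m) ≡ r)

-- Over {a, b} an α-β-factorisation is rigid. Each β_i is the first letter of the reversed arch
-- β_i α_i followed, if different, by the last letter of the arch α_{i-1} β_i; and for ι < k these
-- letters are ∼_k-invariants: at the first pair of arches ending in different letters, the rest of
-- w' would be universal for one more than its number of arches. Each α_i is cut out of w by the m
-- letters around it (last letters of earlier arches, first letters of later reversed arches), which
-- turns w ∼_k w' into α_i ∼_{k-m} α'_i. Conversely the α_i can be exchanged one at a time: the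
-- letters of a scattered factor of length ≤ k beyond the k - m controlled by α_i ∼_{k-m} α'_i can
-- be moved into the universal words on either side.

module Submission where

open import Defs
open import Data.Empty using (⊥-elim)
open import Data.Fin using (Fin; zero; suc; inject₁; opposite)
open import Data.List using ([]; _∷_; _++_; [_]; length; reverse; replicate)
open import Data.List.Membership.Propositional using (_∈_; _∉_)
open import Data.List.Membership.Propositional.Properties using (∈-++⁺ˡ; ∈-++⁺ʳ; ∈-++⁻)
open import Data.List.Properties
  using (++-assoc; ++-identityʳ; ∷ʳ-++; ∷-injectiveʳ; length-++; length-replicate; length-reverse;
         reverse-involutive; reverse-++)
open import Data.List.Relation.Binary.Sublist.Propositional
  using (_⊆_; []; _∷_; _∷ʳ_; ⊆-refl; ⊆-trans; minimum; from∈; to∈)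
open import Data.List.Relation.Binary.Sublist.Propositional.Properties
  using (++⁺; ++⁺ˡ; ++⁺ʳ; ∷ˡ⁻; reverse⁺; reverse⁻)
import Data.List.Relation.Unary.Any.Properties as Any
open import Data.List.Relation.Unary.Any using (here; there)
open import Data.List.Reverse using (Reverse; []; _∶_∶ʳ_; reverseView)
open import Data.Nat using (ℕ; zero; suc; _+_; _∸_; _≤_; _<_; s≤s; _≤?_; _<?_)
open import Data.Nat.Properties
  using (≤-trans; ≤-reflexive; +-suc; +-comm; +-cancelˡ-≤; +-monoˡ-≤; suc-injective; ≮⇒≥; ≰⇒>;
         m∸n+n≡m; m+[n∸m]≡n; m<n⇒0<n∸m; <⇒≤; +-commutativeSemigroup; module ≤-Reasoning)
open import Algebra.Properties.CommutativeSemigroup +-commutativeSemigroup using (x∙yz≈y∙xz)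
open import Data.Product using (∃; ∃₂; _×_; _,_; proj₁; proj₂)
open import Data.Sum using (inj₁; inj₂)
open import Data.Vec using (Vec; []; _∷_; lookup)
open import Data.Vec.Relation.Binary.Pointwise.Extensional using (ext; Pointwise-≡⇒≡)
open import Data.Vec.Relation.Unary.All using (All; []; _∷_)
open import Data.Vec.Relation.Unary.All.Properties using (lookup⁺)
open import Function using (_∘_)
open import Function.Bundles using (_⇔_; mk⇔; Equivalence)
import Function.Properties.Equivalence as ⇔
open import Relation.Nullary using (¬_; Dec; yes; no)
open import Relation.Binary.PropositionalEquality
  using (_≡_; _≢_; refl; sym; trans; cong; cong₂; subst; subst₂)

open Equivalence using (to; from)

_≟_ : (x y : Letter) → Dec (x ≡ y)
a ≟ a = yes refl
a ≟ b = no λ ()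
b ≟ a = no λ ()
b ≟ b = yes refl

-- The only place where |Σ| = 2 is used.
≢-≢⇒≡ : ∀ {x y z : Letter} → x ≢ z → y ≢ z → x ≡ y
≢-≢⇒≡ {a} {a} _ _ = refl
≢-≢⇒≡ {b} {b} _ _ = refl
≢-≢⇒≡ {a} {b} {a} x≢z _ = ⊥-elim (x≢z refl)
≢-≢⇒≡ {a} {b} {b} _ y≢z = ⊥-elim (y≢z refl)
≢-≢⇒≡ {b} {a} {a} _ y≢z = ⊥-elim (y≢z refl)
≢-≢⇒≡ {b} {a} {b} x≢z _ = ⊥-elim (x≢z refl)

∈-∷ʳ⁻ : ∀ {x y : Letter} u → x ∈ u ++ [ y ] → x ≢ y → x ∈ u
∈-∷ʳ⁻ u x∈ x≢y with ∈-++⁻ u x∈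
... | inj₁ x∈u         = x∈u
... | inj₂ (here x≡y) = ⊥-elim (x≢y x≡y)

-- The value at [] is junk; these are only applied to nonempty words.
firstL lastL : Word → Letter
firstL []      = a
firstL (x ∷ _) = x
lastL []          = a
lastL (x ∷ [])    = x
lastL (_ ∷ y ∷ u) = lastL (y ∷ u)

lastL-∷ʳ : ∀ u x → lastL (u ++ [ x ]) ≡ x
lastL-∷ʳ []          x = refl
lastL-∷ʳ (_ ∷ [])    x = refl
lastL-∷ʳ (_ ∷ y ∷ u) x = lastL-∷ʳ (y ∷ u) x

firstL-reverse : ∀ u → firstL (reverse u) ≡ lastL u
firstL-reverse u with reverseView u
... | []           = refl
... | v ∶ _ ∶ʳ x rewrite reverse-++ v [ x ] = sym (lastL-∷ʳ v x)

length-∷ʳ : ∀ (u : Word) x → length (u ++ [ x ]) ≡ suc (length u)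
length-∷ʳ u x = trans (length-++ u) (+-comm (length u) 1)

⊆-++-split : ∀ {x} (u : Word) {v} → x ⊆ u ++ v → ∃₂ λ x₁ x₂ → x ≡ x₁ ++ x₂ × x₁ ⊆ u × x₂ ⊆ v
⊆-++-split []      p = [] , _ , refl , [] , p
⊆-++-split (c ∷ u) (.c ∷ʳ p) with ⊆-++-split u p
... | x₁ , x₂ , refl , p₁ , p₂ = x₁ , x₂ , refl , c ∷ʳ p₁ , p₂
⊆-++-split (c ∷ u) (refl ∷ p) with ⊆-++-split u p
... | x₁ , x₂ , refl , p₁ , p₂ = c ∷ x₁ , x₂ , refl , refl ∷ p₁ , p₂

-- Embeddings of x ∷ y may be taken to match x at its first occurrence.
⊆-skip : ∀ {x : Letter} {y} u {W} → x ∉ u → x ∷ y ⊆ u ++ x ∷ W → y ⊆ W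
⊆-skip []      _   (refl ∷ p) = p
⊆-skip []      _   (_ ∷ʳ p)   = ∷ˡ⁻ p
⊆-skip (c ∷ u) x∉u (.c ∷ʳ p)  = ⊆-skip u (x∉u ∘ there) p
⊆-skip (c ∷ u) x∉u (refl ∷ p) = ⊥-elim (x∉u (here refl))

⊆-skip-⇔ : ∀ {x : Letter} {y} u {W} → x ∉ u → (y ⊆ W) ⇔ (x ∷ y ⊆ u ++ x ∷ W)
⊆-skip-⇔ u x∉u = mk⇔ (++⁺ˡ u ∘ (refl ∷_)) (⊆-skip u x∉u)

⊆-skipʳ : ∀ {x : Letter} y T {W} → x ∉ W → y ++ [ x ] ⊆ T ++ x ∷ W → y ⊆ T
⊆-skipʳ []      T       _   _          = minimum T
⊆-skipʳ (c ∷ y) []      x∉W (refl ∷ p) = ⊥-elim (x∉W (to∈ (⊆-trans (++⁺ˡ y ⊆-refl) p)))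
⊆-skipʳ (c ∷ y) []      x∉W (_ ∷ʳ p)   = ⊥-elim (x∉W (to∈ (⊆-trans (++⁺ˡ (c ∷ y) ⊆-refl) p)))
⊆-skipʳ (c ∷ y) (t ∷ T) x∉W (.t ∷ʳ p)  = t ∷ʳ ⊆-skipʳ (c ∷ y) T x∉W p
⊆-skipʳ (c ∷ y) (t ∷ T) x∉W (refl ∷ p) = refl ∷ ⊆-skipʳ y T x∉W p

⊆-reverse-⇔ : ∀ {y u : Word} → (y ⊆ reverse u) ⇔ (reverse y ⊆ u)
⊆-reverse-⇔ {y} = mk⇔ (reverse⁻ ∘ subst (_⊆ _) (sym (reverse-involutive y)))
                      (subst (_⊆ _) (reverse-involutive y) ∘ reverse⁺)

∼-sym : ∀ {k u v} → u ∼[ k ] v → v ∼[ k ] u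
∼-sym rel x |x| = proj₂ (rel x |x|) , proj₁ (rel x |x|)

∼-reflect : ∀ {k k' u u' v v'} (F : Word → Word) → (∀ {y} → length y ≤ k → length (F y) ≤ k') →
            (∀ {y} → (y ⊆ u) ⇔ (F y ⊆ v)) → (∀ {y} → (y ⊆ u') ⇔ (F y ⊆ v')) →
            v ∼[ k' ] v' → u ∼[ k ] u'
∼-reflect F bound e e' rel y |y| =
  (λ p → from e' (proj₁ (rel (F y) (bound |y|)) (to e p))) ,
  (λ p → from e (proj₂ (rel (F y) (bound |y|)) (to e' p)))

∼-reverse : ∀ {k u v} → u ∼[ k ] v → reverse u ∼[ k ] reverse v
∼-reverse = ∼-reflect reverse (λ {y} → ≤-trans (≤-reflexive (length-reverse y))) ⊆-reverse-⇔ ⊆-reverse-⇔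

∼-skip : ∀ {k} {x : Letter} {u u' W W'} → x ∉ u → x ∉ u' →
         (u ++ x ∷ W) ∼[ suc k ] (u' ++ x ∷ W') → W ∼[ k ] W'
∼-skip x∉u x∉u' = ∼-reflect (_ ∷_) s≤s (⊆-skip-⇔ _ x∉u) (⊆-skip-⇔ _ x∉u')

Universal : ℕ → Word → Set
Universal n W = ∀ y → length y ≡ n → y ⊆ W

universal-zero : ∀ {W} → Universal 0 W
universal-zero [] _ = minimum _

universal-≤ : ∀ {n W} → Universal n W → ∀ y → length y ≤ n → y ⊆ W
universal-≤ {n} U y y≤n = ⊆-trans (++⁺ʳ padding ⊆-refl) (U (y ++ padding) length-padded)
  where
  padding : Word
  padding = replicate (n ∸ length y) a
  length-padded : length (y ++ padding) ≡ n
  length-padded = trans (length-++ y) (trans (cong (length y +_) (length-replicate _)) (m+[n∸m]≡n y≤n))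

universal-prepend : ∀ {n X W} → HasAll X → Universal n W → Universal (suc n) (X ++ W)
universal-prepend all U (c ∷ y) |y| = ++⁺ (from∈ (all c)) (U y (suc-injective |y|))

universal-append : ∀ {n P X} → Universal n P → HasAll X → Universal (suc n) (P ++ X)
universal-append U all y |y| with reverseView y
... | v ∶ _ ∶ʳ c = ++⁺ (U v (suc-injective (trans (sym (length-∷ʳ v c)) |y|))) (from∈ (all c))

∷-universal : ∀ {n l l'} {W : Word} → l ≢ l' → Universal n W →
              (∀ z → length z ≡ n → l' ∷ z ⊆ W) → Universal (suc n) (l ∷ W)
∷-universal {l = l} l≢l' U U' (c ∷ y) |y| with c ≟ l
... | yes refl = refl ∷ U y (suc-injective |y|)
... | no c≢l rewrite ≢-≢⇒≡ c≢l (l≢l' ∘ sym) = l ∷ʳ U' y (suc-injective |y|)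

concatW-arch : ∀ {m} u₀ l (us : Vec Word m) r → concatW ((u₀ ++ [ l ]) ∷ us) ++ r ≡ u₀ ++ l ∷ (concatW us ++ r)
concatW-arch u₀ l us r = trans (++-assoc (u₀ ++ [ l ]) (concatW us) r) (∷ʳ-++ u₀ l _)

archFact-universal : ∀ {m} {ars : Vec Word m} {r} → All IsArch ars → Universal m (concatW ars ++ r)
archFact-universal []                      = universal-zero
archFact-universal {ars = A ∷ as} {r} ((all , _) ∷ ps) =
  subst (Universal _) (sym (++-assoc A (concatW as) r)) (universal-prepend all (archFact-universal ps))

archFact-¬universal : ∀ {m} {ars : Vec Word m} {r} → All IsArch ars → ¬ HasAll r →
                      ¬ Universal (suc m) (concatW ars ++ r)
archFact-¬universal [] ¬all U = ¬all λ c → to∈ (U [ c ] refl)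
archFact-¬universal {ars = _ ∷ as} {r} ((_ , u₀ , l , refl , l∉u₀) ∷ ps) ¬all U =
  archFact-¬universal ps ¬all λ y |y| →
    ⊆-skip u₀ l∉u₀ (subst (l ∷ y ⊆_) (concatW-arch u₀ l as r) (U (l ∷ y) (cong suc |y|)))

-- If the first arches end in different letters l, l', then l ∷ W is (n+1)-universal,
-- and l' ∷ y is found in w for every y of length n+1; transferring to w' makes W' (n+1)-universal.
first-arch-letter : ∀ {n k} {l l' : Letter} {u u' W W'} →
                    HasAll (u ++ [ l ]) → l ∉ u → HasAll (u' ++ [ l' ]) → l' ∉ u' →
                    Universal n W → Universal n W' → ¬ Universal (suc n) W' →
                    (u ++ l ∷ W) ∼[ k ] (u' ++ l' ∷ W') → suc (suc n) ≤ k → l ≡ l'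
first-arch-letter {n} {k} {l} {l'} {u} {u'} {W} {W'} all l∉u all' l'∉u' U U' ¬U'₊ rel 2+n≤k with l ≟ l'
... | yes l≡l' = l≡l'
... | no l≢l'  = ⊥-elim (¬U'₊ U'₊)
  where
  bound : ∀ y → length y ≡ suc n → suc (length y) ≤ k
  bound _ |y| = subst (λ j → suc j ≤ k) (sym |y|) 2+n≤k

  l'∷-⊆ : ∀ z → length z ≡ n → l' ∷ z ⊆ W
  l'∷-⊆ z |z| = ⊆-skip u l∉u (proj₂ (rel (l ∷ l' ∷ z) (bound (l' ∷ z) (cong suc |z|)))
                   (++⁺ (from∈ (∈-∷ʳ⁻ u' (all' l) l≢l')) (refl ∷ U' z |z|)))

  U'₊ : Universal (suc n) W'
  U'₊ y |y| = ⊆-skip u' l'∉u' (proj₁ (rel (l' ∷ y) (bound y |y|))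
                (++⁺ (from∈ (∈-∷ʳ⁻ u (all l') (l≢l' ∘ sym))) (∷-universal l≢l' U l'∷-⊆ y |y|)))

archFact-lastL-≡ : ∀ {m k} {ars ars' : Vec Word m} {r r'} →
                   All IsArch ars → ¬ HasAll r → All IsArch ars' → ¬ HasAll r' →
                   (concatW ars ++ r) ∼[ k ] (concatW ars' ++ r') → m < k →
                   ∀ i → lastL (lookup ars i) ≡ lastL (lookup ars' i)
archFact-lastL-≡ {k = k} {_ ∷ as} {_ ∷ as'} {r} {r'}
  ((all , u₀ , l , refl , l∉u₀) ∷ ps) ¬all ((all' , u₀' , l' , refl , l'∉u₀') ∷ ps') ¬all' rel (s≤s m<k)
  = lastL-≡ (first-arch-letter all l∉u₀ all' l'∉u₀' (archFact-universal ps) (archFact-universal ps')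
               (archFact-¬universal ps' ¬all') rel′ (s≤s m<k))
  where
  rel′ : (u₀ ++ l ∷ (concatW as ++ r)) ∼[ k ] (u₀' ++ l' ∷ (concatW as' ++ r'))
  rel′ = subst₂ (_∼[ k ]_) (concatW-arch u₀ l as r) (concatW-arch u₀' l' as' r') rel
  lastL-≡ : l ≡ l' → ∀ i → lastL (lookup ((u₀ ++ [ l ]) ∷ as) i) ≡ lastL (lookup ((u₀' ++ [ l' ]) ∷ as') i)
  lastL-≡ refl zero    = trans (lastL-∷ʳ u₀ l) (sym (lastL-∷ʳ u₀' l))
  lastL-≡ refl (suc i) = archFact-lastL-≡ ps ¬all ps' ¬all' (∼-skip l∉u₀ l'∉u₀' rel′) m<k i

IsArchᴿ : Word → Set
IsArchᴿ u = HasAll u × ∃₂ λ f rest → u ≡ f ∷ rest × f ∉ rest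

reverse-arch : ∀ {u} → IsArch u → IsArchᴿ (reverse u)
reverse-arch (all , u₀ , l , refl , l∉u₀) =
  Any.reverse⁺ ∘ all , l , reverse u₀ , reverse-++ u₀ [ l ] , l∉u₀ ∘ Any.reverse⁻

abTail : ∀ {m} → Vec Word m → Vec Word m → Word
abTail []       []       = []
abTail (β ∷ βs) (α ∷ αs) = β ++ α ++ abTail βs αs

abConcat-∷ : ∀ {m} α (αs : Vec Word m) βs → abConcat (α ∷ αs) βs ≡ α ++ abTail βs αs
abConcat-∷ α []        []       = sym (++-identityʳ α)
abConcat-∷ α (α₁ ∷ αs) (β ∷ βs) = cong (λ v → α ++ β ++ v) (abConcat-∷ α₁ αs βs)

-- ABChain α₀ (β₁ ⋯ βₘ) (α₁ ⋯ αₘ) describes α₀ β₁ α₁ ⋯ βₘ αₘ.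
data ABChain : ∀ {m} → Word → Vec Word m → Vec Word m → Set where
  end  : ∀ {α} → ABChain α [] []
  link : ∀ {m α x βt α₁} {βs αs : Vec Word m} →
         IsArch (α ++ x ∷ βt) → HasAll (x ∷ βt ++ α₁) → x ∉ βt ++ α₁ →
         ABChain α₁ βs αs → ABChain α ((x ∷ βt) ∷ βs) (α₁ ∷ αs)

lookups⇒abChain : ∀ {m} α (αs : Vec Word m) βs → ¬ HasAll α →
          (∀ i → IsArch (lookup (α ∷ αs) (inject₁ i) ++ lookup βs i)) →
          (∀ i → IsArchᴿ (lookup βs i ++ lookup αs i)) → ABChain α βs αs
lookups⇒abChain α []        []              _    _    _    = end
lookups⇒abChain α (α₁ ∷ αs) ([] ∷ βs)       ¬all arch _    =
  ⊥-elim (¬all (subst HasAll (++-identityʳ α) (proj₁ (arch zero))))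
lookups⇒abChain α (α₁ ∷ αs) ((x ∷ βt) ∷ βs) ¬all arch archᴿ with archᴿ zero
... | all , _ , _ , refl , x∉ =
  link (arch zero) all x∉ (lookups⇒abChain α₁ αs βs (λ all₁ → x∉ (∈-++⁺ʳ βt (all₁ x))) (arch ∘ suc) (archᴿ ∘ suc))

abFact⇒abChain : ∀ {w m α αs βs} → IsABFact w m (α ∷ αs) βs → ABChain α βs αs
abFact⇒abChain (_ , _ , _ , _ , (_ , arches , _) , (_ , archesᴿ , ¬allᴿ) , _ , arch , archᴿ , α≡ , _) =
  lookups⇒abChain _ _ _ (subst (¬_ ∘ HasAll) (sym α≡) (¬allᴿ ∘ (Any.reverse⁻ ∘_)))
    (λ i → subst IsArch (arch i) (lookup⁺ arches i))
    (λ i → subst IsArchᴿ (archᴿ i) (reverse-arch (lookup⁺ archesᴿ (opposite i))))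

-- The β's are determined by the letters at the ends of the arches

canon : Letter → Letter → Word
canon x l with x ≟ l
... | yes _ = [ x ]
... | no _  = x ∷ l ∷ []

bordered-canon : ∀ {x l : Letter} {βt} β₀ → x ∷ βt ≡ β₀ ++ [ l ] → x ∉ βt → l ∉ β₀ → x ∷ βt ≡ canon x l
bordered-canon {x} [] refl _ _ with x ≟ x
... | yes _   = refl
... | no x≢x = ⊥-elim (x≢x refl)
bordered-canon {x} {l} (_ ∷ []) refl x∉βt _ with x ≟ l
... | yes refl = ⊥-elim (x∉βt (here refl))
... | no _     = refl
bordered-canon {x} {l} (_ ∷ z ∷ _) refl x∉βt l∉β₀ with x ≟ l
... | yes refl = ⊥-elim (l∉β₀ (here refl))
... | no x≢l   = ⊥-elim (x∉βt (here (≢-≢⇒≡ x≢l z≢l)))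
  where
  z≢l : z ≢ l
  z≢l refl = l∉β₀ (there (here refl))

arch-suffix : ∀ α {x βt u₀ l} → α ++ x ∷ βt ≡ u₀ ++ [ l ] → l ∉ u₀ →
              ∃ λ (β₀ : Word) → x ∷ βt ≡ β₀ ++ [ l ] × l ∉ β₀
arch-suffix []                        e    l∉u₀ = _ , e , l∉u₀
arch-suffix (_ ∷ [])    {u₀ = []}     ()   _
arch-suffix (_ ∷ _ ∷ _) {u₀ = []}     ()   _
arch-suffix (_ ∷ α)     {u₀ = _ ∷ _}  e    l∉u₀ = arch-suffix α (∷-injectiveʳ e) (l∉u₀ ∘ there)

arch-suffix-lastL : ∀ α {x βt u₀ l} → α ++ x ∷ βt ≡ u₀ ++ [ l ] → l ∉ u₀ → lastL (x ∷ βt) ≡ l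
arch-suffix-lastL α e l∉u₀ with arch-suffix α e l∉u₀
... | β₀ , e′ , _ = trans (cong lastL e′) (lastL-∷ʳ β₀ _)

lastL-arch : ∀ (α : Word) {β u₀ l} → α ++ β ≡ u₀ ++ [ l ] → lastL (α ++ β) ≡ l
lastL-arch _ {u₀ = u₀} e = trans (cong lastL e) (lastL-∷ʳ u₀ _)

β-canonical : ∀ α {x βt α₁ u₀ l} → α ++ x ∷ βt ≡ u₀ ++ [ l ] → l ∉ u₀ → x ∉ βt ++ α₁ →
              x ∷ βt ≡ canon x l
β-canonical α e l∉u₀ x∉ with arch-suffix α e l∉u₀
... | β₀ , e′ , l∉β₀ = bordered-canon β₀ e′ (x∉ ∘ ∈-++⁺ˡ) l∉β₀

βs-unique : ∀ {m α α'} {βs βs' αs αs' : Vec Word m} → ABChain α βs αs → ABChain α' βs' αs' →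
            (∀ i → lastL (lookup (α ∷ αs) (inject₁ i) ++ lookup βs i)
                 ≡ lastL (lookup (α' ∷ αs') (inject₁ i) ++ lookup βs' i)) →
            (∀ i → firstL (lookup βs i ++ lookup αs i) ≡ firstL (lookup βs' i ++ lookup αs' i)) →
            βs ≡ βs'
βs-unique end end _ _ = refl
βs-unique {α = α} {α'} (link (_ , u₀ , l , e , l∉u₀) _ x∉ c) (link (_ , u₀' , l' , e' , l'∉u₀') _ x'∉ c')
          lasts firsts =
  cong₂ _∷_ (trans (β-canonical α e l∉u₀ x∉)
                   (trans (cong₂ canon (firsts zero) l≡l') (sym (β-canonical α' e' l'∉u₀' x'∉))))
            (βs-unique c c' (lasts ∘ suc) (firsts ∘ suc))
  where
  l≡l' : l ≡ l'
  l≡l' = trans (sym (lastL-arch α e)) (trans (lasts zero) (lastL-arch α' e'))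

-- α_i is cut out of w by a context of m letters

++-assoc₃ : ∀ (T U V R : Word) → (T ++ U ++ V) ++ R ≡ T ++ U ++ V ++ R
++-assoc₃ T U V R = trans (++-assoc T (U ++ V) R) (cong (T ++_) (++-assoc U V R))

arch-++ : ∀ (α β : Word) {u₀ l} → α ++ β ≡ u₀ ++ [ l ] → ∀ V → α ++ β ++ V ≡ u₀ ++ l ∷ V
arch-++ α β {u₀} {l} e V = trans (sym (++-assoc α β V)) (trans (cong (_++ V) e) (∷ʳ-++ u₀ l V))

probeL probeR : ∀ {m} → Fin (suc m) → Vec Word m → Word
probeL zero    _        = []
probeL (suc i) (β ∷ βs) = lastL β ∷ probeL i βs
probeR zero    []       = []
probeR zero    (β ∷ βs) = firstL β ∷ probeR zero βs
probeR (suc i) (_ ∷ βs) = probeR i βs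

length-probes : ∀ {m} (i : Fin (suc m)) βs → length (probeL i βs) + length (probeR i βs) ≡ m
length-probes zero    []       = refl
length-probes zero    (_ ∷ βs) = cong suc (length-probes zero βs)
length-probes (suc i) (_ ∷ βs) = cong suc (length-probes i βs)

probeR-⊆ : ∀ {m α} {βs αs : Vec Word m} → ABChain α βs αs → probeR zero βs ⊆ abTail βs αs
probeR-⊆ end                           = []
probeR-⊆ (link {βt = βt} {α₁} _ _ _ c) = refl ∷ ++⁺ˡ βt (++⁺ˡ α₁ (probeR-⊆ c))

probeR-cancel : ∀ {m α} {βs αs : Vec Word m} → ABChain α βs αs →
                ∀ y T → y ++ probeR zero βs ⊆ T ++ abTail βs αs → y ⊆ T
probeR-cancel end y T = subst₂ _⊆_ (++-identityʳ y) (++-identityʳ T)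
probeR-cancel (link {x = x} {βt} {α₁} {βs = βs} {αs} _ _ x∉ c) y T p =
  ⊆-skipʳ y T x∉ (probeR-cancel c (y ++ [ x ]) (T ++ x ∷ βt ++ α₁)
    (subst₂ _⊆_ (sym (∷ʳ-++ y x _)) (sym (++-assoc₃ T (x ∷ βt) α₁ (abTail βs αs))) p))

α-context : ∀ {m α} {βs αs : Vec Word m} → ABChain α βs αs → ∀ i {z} →
            (z ⊆ lookup (α ∷ αs) i) ⇔ (probeL i βs ++ z ++ probeR i βs ⊆ α ++ abTail βs αs)
α-context c zero = mk⇔ (λ p → ++⁺ p (probeR-⊆ c)) (probeR-cancel c _ _)
α-context (link {α = α} {x} {βt} {α₁} {βs} {αs} (_ , u₀ , _ , e , l∉u₀) _ _ c) (suc i) {z} =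
  subst₂ (λ h v → (z ⊆ _) ⇔ (h ∷ probeL i βs ++ z ++ probeR i βs ⊆ v))
    (sym (arch-suffix-lastL α e l∉u₀)) (sym (arch-++ α (x ∷ βt) e (α₁ ++ abTail βs αs)))
    (⇔.trans (α-context c i) (⊆-skip-⇔ u₀ l∉u₀))

+-≤-cancel : ∀ {m n o p} → m + n ≤ o + p → o ≤ m → n ≤ p
+-≤-cancel {m} {n} {o} {p} le o≤m = +-cancelˡ-≤ o n p (≤-trans (+-monoˡ-≤ n o≤m) le)

+-<-cancel : ∀ {m n o p} → m + n ≤ o + p → o < m → n < p
+-<-cancel {m} {n} {o} {p} le o<m = +-≤-cancel (subst (_≤ suc (o + p)) (sym (+-suc m n)) (s≤s le)) o<m

-- A scattered factor of L α R too long to fit into α alone overflows into L or R, where every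
-- short enough word is found anyway.
module _ {i n j} {L α α' R : Word} (UL : Universal i L) (UR : Universal j R) (α∼α' : α ∼[ n ] α') where

  private
    shiftʳ : ∀ {xM xR} → Reverse xM → xM ⊆ α → xR ⊆ R → length (xM ++ xR) ≤ n + j → xM ++ xR ⊆ α' ++ R
    shiftʳ []            _  pR _ = ++⁺ˡ α' pR
    shiftʳ {xR = xR} (xs ∶ v ∶ʳ c) pM pR bound with length (xs ++ [ c ]) ≤? n
    ... | yes ≤n = ++⁺ (proj₁ (α∼α' _ ≤n) pM) pR
    ... | no ≰n  = subst (_⊆ α' ++ R) (sym (∷ʳ-++ xs c xR))
                     (shiftʳ v (⊆-trans (++⁺ʳ [ c ] ⊆-refl) pM) (universal-≤ UR (c ∷ xR) c∷xR≤j)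
                       (subst (λ y → length y ≤ n + j) (∷ʳ-++ xs c xR) bound))
      where
      c∷xR≤j : suc (length xR) ≤ j
      c∷xR≤j = +-<-cancel (subst (_≤ n + j) (length-++ (xs ++ [ c ])) bound) (≰⇒> ≰n)

    shiftˡ : ∀ xL xM {xR} → xL ⊆ L → xM ⊆ α → xR ⊆ R → length (xL ++ xM ++ xR) ≤ i + (n + j) →
             xL ++ xM ++ xR ⊆ L ++ α' ++ R
    shiftˡ xL []       pL _  pR _ = ++⁺ pL (++⁺ˡ α' pR)
    shiftˡ xL (c ∷ xM) {xR} pL pM pR bound with length xL <? i
    ... | yes xL<i = subst (_⊆ L ++ α' ++ R) (∷ʳ-++ xL c (xM ++ xR))
                       (shiftˡ (xL ++ [ c ]) xM (universal-≤ UL _ (subst (_≤ i) (sym (length-∷ʳ xL c)) xL<i))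
                         (∷ˡ⁻ pM) pR (subst (λ y → length y ≤ i + (n + j)) (sym (∷ʳ-++ xL c (xM ++ xR))) bound))
    ... | no xL≮i  = ++⁺ pL (shiftʳ (reverseView (c ∷ xM)) pM pR
                       (+-≤-cancel (subst (_≤ _) (length-++ xL) bound) (≮⇒≥ xL≮i)))

  ⊆-shift : ∀ {x} → length x ≤ i + (n + j) → x ⊆ L ++ α ++ R → x ⊆ L ++ α' ++ R
  ⊆-shift bound p with ⊆-++-split L p
  ... | xL , _ , refl , pL , p₂ with ⊆-++-split α p₂
  ... | xM , xR , refl , pM , pR = shiftˡ xL xM pL pM pR bound

HasAll-∼ : ∀ {n α α' β} → 1 ≤ n → α ∼[ n ] α' → HasAll (α ++ β) → HasAll (α' ++ β)
HasAll-∼ {α = α} n≥1 α∼α' all c with ∈-++⁻ α (all c)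
... | inj₁ c∈α = ∈-++⁺ˡ (to∈ (proj₁ (α∼α' [ c ] n≥1) (from∈ c∈α)))
... | inj₂ c∈β = ∈-++⁺ʳ _ c∈β

abTail-universal : ∀ {m α} {βs αs : Vec Word m} → ABChain α βs αs → Universal m (abTail βs αs)
abTail-universal end = universal-zero
abTail-universal (link {x = x} {βt} {α₁} {βs = βs} {αs} _ all _ c) =
  subst (Universal _) (++-assoc (x ∷ βt) α₁ (abTail βs αs)) (universal-prepend all (abTail-universal c))

⊆-transfer : ∀ {m n i α α'} {βs αs αs' : Vec Word m} {P y} → 1 ≤ n → ABChain α βs αs →
             (∀ j → lookup (α ∷ αs) j ∼[ n ] lookup (α' ∷ αs') j) → Universal i P →
             length y ≤ i + (n + m) → y ⊆ P ++ α ++ abTail βs αs → y ⊆ P ++ α' ++ abTail βs αs'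
⊆-transfer {αs' = []} _ end α∼ UP bound = ⊆-shift UP universal-zero (α∼ zero) bound
⊆-transfer {suc m} {n} {i} {α' = α'} {αs' = α₁' ∷ αs'} {P} {y} n≥1 c@(link {x = x} {βt} (all , _) _ _ c₁)
           α∼ UP bound p =
  subst (_ ⊆_) (++-assoc₃ P α' (x ∷ βt) _)
    (⊆-transfer n≥1 c₁ (α∼ ∘ suc) (universal-append UP (HasAll-∼ n≥1 (α∼ zero) all)) bound′
      (subst (_ ⊆_) (sym (++-assoc₃ P α' (x ∷ βt) _)) (⊆-shift UP (abTail-universal c) (α∼ zero) bound p)))
  where
  bound′ : length y ≤ suc i + (n + m)
  bound′ = subst (length y ≤_) (trans (cong (i +_) (+-suc n m)) (+-suc i (n + m))) bound

abFact-word : ∀ {w m α αs βs} → IsABFact w m (α ∷ αs) βs → w ≡ α ++ abTail βs αs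
abFact-word {α = α} {αs} {βs} (_ , _ , _ , _ , _ , _ , w≡ , _) = trans w≡ (abConcat-∷ α αs βs)

∼⇒βs-≡ : ∀ {k w w' m α α'} {αs αs' βs βs' : Vec Word m} → m < k →
         IsABFact w m (α ∷ αs) βs → IsABFact w' m (α' ∷ αs') βs' → w ∼[ k ] w' → βs ≡ βs'
∼⇒βs-≡ {k} {α = α} {α'} {αs} {αs'} {βs} {βs'} m<k
  F@(ars , _ , arsᴿ , _ , (w≡ , arches , ¬all) , (wᴿ≡ , archesᴿ , ¬allᴿ) , _ , arch , archᴿ , _)
  F'@(ars' , _ , arsᴿ' , _ , (w'≡ , arches' , ¬all') , (w'ᴿ≡ , archesᴿ' , ¬allᴿ') , _ , arch' , archᴿ' , _) rel =
  βs-unique (abFact⇒abChain F) (abFact⇒abChain F') lasts firsts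
  where
  lastsᴬ : ∀ i → lastL (lookup ars i) ≡ lastL (lookup ars' i)
  lastsᴬ = archFact-lastL-≡ arches ¬all arches' ¬all' (subst₂ (_∼[ k ]_) w≡ w'≡ rel) m<k
  lastsᴿ : ∀ i → lastL (lookup arsᴿ i) ≡ lastL (lookup arsᴿ' i)
  lastsᴿ = archFact-lastL-≡ archesᴿ ¬allᴿ archesᴿ' ¬allᴿ' (subst₂ (_∼[ k ]_) wᴿ≡ w'ᴿ≡ (∼-reverse rel)) m<k

  lasts : ∀ i → lastL (lookup (α ∷ αs) (inject₁ i) ++ lookup βs i)
              ≡ lastL (lookup (α' ∷ αs') (inject₁ i) ++ lookup βs' i)
  lasts i = trans (cong lastL (sym (arch i))) (trans (lastsᴬ i) (cong lastL (arch' i)))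

  firsts : ∀ i → firstL (lookup βs i ++ lookup αs i) ≡ firstL (lookup βs' i ++ lookup αs' i)
  firsts i = trans (cong firstL (sym (archᴿ i)))
               (trans (firstL-reverse (lookup arsᴿ (opposite i))) (trans (lastsᴿ (opposite i))
                 (trans (sym (firstL-reverse (lookup arsᴿ' (opposite i)))) (cong firstL (archᴿ' i)))))

probe-length≤ : ∀ {k m} (i : Fin (suc m)) βs {z} → m ≤ k → length z ≤ k ∸ m →
                length (probeL i βs ++ z ++ probeR i βs) ≤ k
probe-length≤ {k} {m} i βs {z} m≤k |z| = begin
  length (P ++ z ++ S)            ≡⟨ trans (length-++ P) (cong (length P +_) (length-++ z)) ⟩
  length P + (length z + length S) ≡⟨ x∙yz≈y∙xz (length P) (length z) (length S) ⟩
  length z + (length P + length S) ≡⟨ cong (length z +_) (length-probes i βs) ⟩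
  length z + m                     ≤⟨ +-monoˡ-≤ m |z| ⟩
  k ∸ m + m                        ≡⟨ m∸n+n≡m m≤k ⟩
  k                                ∎
  where
  open ≤-Reasoning
  P S : Word
  P = probeL i βs
  S = probeR i βs

abChain-∼-⇔ : ∀ {k m α α'} {βs αs αs' : Vec Word m} → m < k → ABChain α βs αs → ABChain α' βs αs' →
              ((α ++ abTail βs αs) ∼[ k ] (α' ++ abTail βs αs'))
              ⇔ (∀ i → lookup (α ∷ αs) i ∼[ k ∸ m ] lookup (α' ∷ αs') i)
abChain-∼-⇔ {k} {m} {βs = βs} m<k c c' = mk⇔
  (λ rel i → ∼-reflect (λ z → probeL i βs ++ z ++ probeR i βs) (probe-length≤ i βs (<⇒≤ m<k))
               (α-context c i) (α-context c' i) rel)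
  (λ α∼ y |y| → ⊆-transfer {P = []} {y} n≥1 c α∼ universal-zero (bound y |y|) ,
                ⊆-transfer {P = []} {y} n≥1 c' (∼-sym ∘ α∼) universal-zero (bound y |y|))
  where
  n≥1 : 1 ≤ k ∸ m
  n≥1 = m<n⇒0<n∸m m<k
  bound : ∀ y → length y ≤ k → length y ≤ k ∸ m + m
  bound y = subst (length y ≤_) (sym (m∸n+n≡m (<⇒≤ m<k)))

theorem2 : (k : ℕ) (w w' : Word) (m : ℕ)
    → IsIota w m → IsIota w' m → m < k
    → (αs : Vec Word (suc m)) (βs : Vec Word m)
    → (αs' : Vec Word (suc m)) (βs' : Vec Word m)
    → IsABFact w m αs βs → IsABFact w' m αs' βs'
    → (w ∼[ k ] w') ⇔ ((∀ (i : Fin m) → lookup βs i ≡ lookup βs' i)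
    × (∀ (i : Fin (suc m)) → lookup αs i ∼[ k ∸ m ] lookup αs' i))
theorem2 k w w' m _ _ m<k (α ∷ αs) βs (α' ∷ αs') βs' F F' = mk⇔
  (λ rel → let βs≡βs' = ∼⇒βs-≡ m<k F F' rel in
           (λ i → cong (λ v → lookup v i) βs≡βs') , to (∼-⇔-αs βs≡βs') rel)
  (λ (βs≗βs' , α∼) → from (∼-⇔-αs (Pointwise-≡⇒≡ (ext βs≗βs'))) α∼)
  where
  ∼-⇔-αs : βs ≡ βs' → (w ∼[ k ] w') ⇔ (∀ i → lookup (α ∷ αs) i ∼[ k ∸ m ] lookup (α' ∷ αs') i)
  ∼-⇔-αs βs≡βs' =
    subst₂ (λ u v → (u ∼[ k ] v) ⇔ _) (sym (abFact-word F)) (sym w'≡)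
      (abChain-∼-⇔ m<k (abFact⇒abChain F) (subst (λ v → ABChain α' v αs') (sym βs≡βs') (abFact⇒abChain F')))
    where
    w'≡ : w' ≡ α' ++ abTail βs αs'
    w'≡ = trans (abFact-word F') (cong (λ v → α' ++ abTail v αs') (sym βs≡βs'))
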